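{- Let $\Lambda$ be a normal greedoid over a finite alphabet $\Sigma$ and $\rho:2^\Sigma\to\mathbb{R}$ a polymatroid rank function which is a representation of $\Lambda$. If $\rho$ is integral (takes only integer values), then $\rho$ is an aligned representation of $\Lambda$.
   Context: Words: $\Sigma^*$ is the set of finite words over $\Sigma$; a word is simple if no letter repeats; $\tilde\alpha$ is the set of letters of $\alpha$, $|\alpha|$ its length. A greedoid over $\Sigma$ is a nonempty language $\Lambda\subseteq\Sigma^*$ of simple words with (i) $\alpha\beta\in\Lambda\Rightarrow\alpha\in\Lambda$, (ii) if $\alpha,\beta\in\Lambda$, $|\alpha|>|\beta|$, then $\beta x\in\Lambda$ for some $x\in\tilde\alpha$. Elements are feasible; $\Lambda$ is normal if every letter occurs in some feasible word. Continuations: $\Gamma[\alpha]=\{x:\alpha x\in\Lambda\}$. Flats: $\alpha\sim\beta$ iff $\Gamma[\alpha]=\Gamma[\beta]$; $[\alpha]$ the class, $\Lambda/\mathord{\sim}$ the flats, ordered by $[\alpha]\sqsubset[\beta]$ iff some nonempty $\beta'$ has $\alpha\beta'\in\Lambda$ and $\alpha\beta'\sim\beta$; $\mathcal{L}_\Lambda$ is this poset, $\prec$ its covering relation. A polymatroid rank function is $\rho:2^\Sigma\to\mathbb{R}$ with $\rho(\emptyset)=0$, monotone and submodular. Span $\sigma_\rho(X)=\{y:\rho(X\cup\{y\})=\rho(X)\}$; closed sets satisfy $X=\sigma_\rho(X)$; $\mathcal{L}_\rho$ is the lattice of closed sets under inclusion. $\rho$ is a representation of $\Lambda$ if $\Lambda=\{x_1\cdots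 x_k\in\Sigma^*:\rho(\{x_1,\dots,x_i\})=i\ \forall i\le k\}$. A representation $\rho$ of a normal greedoid is aligned if there is an order preserving $\varphi:\mathcal{L}_\Lambda\to\mathcal{L}_\rho$ ($F\sqsubset F'\Rightarrow\varphi(F)\subsetneq\varphi(F')$) with $\rho(\tilde\alpha)=\rho(\varphi[\alpha])$ and $\tilde\alpha\subseteq\varphi[\alpha]$ for all $\alpha\in\Lambda$, and $F\prec F'\Rightarrow\varphi(F)\prec\varphi(F')$. -}

module Defs where

open import Data.Nat using (ℕ; _≤_; _>_)
open import Data.Integer as ℤ using (ℤ; +_)
open import Data.Fin using (Fin)
open import Data.Fin.Subset as S using (Subset; ⁅_⁆; _∪_; _∩_; _⊆_; _⊂_)
open import Data.List using (List; []; _∷_; _++_; [_]; length; take)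
open import Data.List.Membership.Propositional as L using ()
open import Data.List.Relation.Unary.Unique.Propositional using (Unique)
open import Data.Product using (Σ; ∃; _×_)
open import Relation.Binary.PropositionalEquality using (_≡_; _≢_)
open import Relation.Nullary using (¬_)
open import Function.Bundles using (_⇔_)

Word : ℕ → Set
Word n = List (Fin n)

Language : ℕ → Set₁
Language n = Word n → Set

letters : {n : ℕ} → Word n → Subset n
letters [] = S.⊥
letters (x ∷ α) = ⁅ x ⁆ ∪ letters α

record IsGreedoid {n : ℕ} (Λ : Language n) : Set where
  field
    nonempty  : ∃ λ α → Λ α
    simple    : ∀ α → Λ α → Unique α
    prefix    : ∀ α β → Λ (α ++ β) → Λ α
    exchange  : ∀ α β → Λ α → Λ β → length α > length β →
                ∃ λ x → x L.∈ α × Λ (β ++ [ x ])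

Normal : {n : ℕ} → Language n → Set
Normal Λ = ∀ x → ∃ λ α → Λ α × x L.∈ α

module _ {n : ℕ} (Λ : Language n) where
  -- α ∼ β iff Γ[α] = Γ[β]
  _∼_ : Word n → Word n → Set
  α ∼ β = ∀ x → Λ (α ++ [ x ]) ⇔ Λ (β ++ [ x ])

  -- [α] ⊏ [β] (on representatives)
  _⊏_ : Word n → Word n → Set
  α ⊏ β = ∃ λ β' → β' ≢ [] × Λ (α ++ β') × ((α ++ β') ∼ β)

  _≺_ : Word n → Word n → Set
  α ≺ β = α ⊏ β × ¬ (∃ λ γ → Λ γ × α ⊏ γ × γ ⊏ β)

-- Integer-valued (integral) polymatroid rank functions.
record IsPolymatroid {n : ℕ} (ρ : Subset n → ℤ) : Set where
  field
    empty       : ρ S.⊥ ≡ + 0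
    monotone    : ∀ X Y → X ⊆ Y → ρ X ℤ.≤ ρ Y
    submodular  : ∀ X Y → (ρ (X ∪ Y) ℤ.+ ρ (X ∩ Y)) ℤ.≤ (ρ X ℤ.+ ρ Y)

module _ {n : ℕ} (ρ : Subset n → ℤ) where
  Closed : Subset n → Set
  Closed X = ∀ y → (y S.∈ X) ⇔ (ρ (X ∪ ⁅ y ⁆) ≡ ρ X)

  _≺ρ_ : Subset n → Subset n → Set
  X ≺ρ Y = X ⊂ Y × ¬ (∃ λ Z → Closed Z × X ⊂ Z × Z ⊂ Y)

Represents : {n : ℕ} → (Subset n → ℤ) → Language n → Set
Represents ρ Λ = ∀ w → Λ w ⇔ (∀ i → i ≤ length w → ρ (letters (take i w)) ≡ + i)

-- Aligned representation.  φ : L_Λ → L_ρ is given on feasible representatives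
-- and required to be constant on ∼-classes.
record AlignedMap {n : ℕ} (Λ : Language n) (ρ : Subset n → ℤ)
                  (φ : Word n → Subset n) : Set where
  field
    wellDefined : ∀ α β → Λ α → Λ β → _∼_ Λ α β → φ α ≡ φ β
    closed      : ∀ α → Λ α → Closed ρ (φ α)
    monotone    : ∀ α β → Λ α → Λ β → _⊏_ Λ α β → φ α ⊂ φ β
    sameRank    : ∀ α → Λ α → ρ (letters α) ≡ ρ (φ α)
    contains    : ∀ α → Λ α → letters α ⊆ φ α
    covers      : ∀ α β → Λ α → Λ β → _≺_ Λ α β → _≺ρ_ ρ (φ α) (φ β)

Aligned : {n : ℕ} → Language n → (Subset n → ℤ) → Set
Aligned Λ ρ = Represents ρ Λ × ∃ λ φ → AlignedMap Λ ρ φ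

{-# OPTIONS --safe #-}
-- The aligned map sends a feasible word α to the span φ α = σ(α̃) of its letters, which is closed,
-- contains α̃ and has the same rank. Integrality is what makes φ constant on flats: if α ∼ β, then
-- along a feasible ordering of α each letter x raises the rank of σ(β̃) by at most one
-- (submodularity), but not by exactly one, since then βx and hence αx would be feasible although x
-- occurs in α; so x ∈ σ(β̃). Hence ρ(φ α) = |α|, and a closed set strictly between φ α and φ β
-- forces |β| ≥ |α| + 2, so a one-letter extension of α would be a flat strictly between [α] and [β].
module Submission where

open import Defs
open import Data.Nat using (ℕ)
open import Data.Integer using (ℤ)
open import Data.Fin.Subset using (Subset)

open import Data.Bool using (true)
open import Data.Empty using (⊥-elim)
open import Data.Fin using (Fin)
open import Data.Fin.Subset using (⁅_⁆; _∪_; _∩_; _∈_; _∉_; _⊆_; _⊂_)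
open import Data.Fin.Subset.Properties
  using (_∈?_; ⊥⊆; ⊆-antisym; p⊆p∪q; q⊆p∪q; x∈p∪q⁻; x∈p∩q⁺; x∈⁅y⁆⇔x≡y;
         ∪-identityˡ; ∪-identityʳ; ∪-assoc)
open import Data.Integer as ℤ using (+_; ∣_∣)
open import Data.Integer.Properties using (0≤i⇒+∣i∣≡i; drop‿+≤+)
open import Data.List using (List; []; _∷_; _++_; [_]; _∷ʳ_; length; take; filter; allFin)
open import Data.List.Properties using (length-++; length-++-≤ˡ; take-all; ∷ʳ-++)
open import Data.List.Membership.Propositional using () renaming (_∈_ to _∈ₗ_)
open import Data.List.Membership.Propositional.Properties using (∈-++⁺ʳ; ∈-allFin; ∈-filter⁺; ∈-filter⁻)
open import Data.List.Relation.Unary.Any using (here; there)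
open import Data.Nat using (zero; suc; _+_; _≤_; _<_; _≤?_; s≤s)
open import Data.Nat.Properties
  using (≤-refl; ≤-reflexive; ≤-trans; ≤-antisym; ≤∧≢⇒<; m<1+n⇒m≤n; m≤n⇒m<n∨m≡n; 1+n≰n;
         +-comm; +-monoˡ-≤; +-monoʳ-≤; +-cancelˡ-≤; module ≤-Reasoning)
open import Data.Nat.Tactic.RingSolver using (solve-∀)
open import Data.Product using (∃; _×_; _,_; proj₂)
open import Data.Sum using (inj₁; inj₂; [_,_]′)
open import Data.Vec using (tabulate)
open import Data.Vec.Properties using (lookup∘tabulate; []=⇒lookup; lookup⇒[]=)
open import Function using (_∘_; id)
open import Function.Bundles using (_⇔_; mk⇔; Equivalence)
import Function.Properties.Equivalence as ⇔
open import Relation.Binary.PropositionalEquality using (_≡_; _≢_; refl; sym; trans; cong; cong₂; subst; subst₂; module ≡-Reasoning)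
open import Relation.Nullary using (Dec; yes; does; ¬_)
open import Relation.Nullary.Decidable using (dec-true)

module _ {A : Set} where

  take-++ˡ : {i : ℕ} (xs ys : List A) → i ≤ length xs → take i (xs ++ ys) ≡ take i xs
  take-++ˡ {zero}  xs       ys _          = refl
  take-++ˡ {suc i} (x ∷ xs) ys (s≤s i≤xs) = cong (x ∷_) (take-++ˡ xs ys i≤xs)

  length-∷ʳ : (xs : List A) (x : A) → length (xs ∷ʳ x) ≡ suc (length xs)
  length-∷ʳ xs x = trans (length-++ xs) (+-comm (length xs) 1)

does-true⇒ : {A : Set} (a? : Dec A) → does a? ≡ true → A
does-true⇒ (yes a) _ = a

module _ {n : ℕ} where

  ∪-lub : {p q r : Subset n} → p ⊆ r → q ⊆ r → p ∪ q ⊆ r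
  ∪-lub {p} {q} p⊆r q⊆r x∈p∪q = [ p⊆r , q⊆r ]′ (x∈p∪q⁻ p q x∈p∪q)

  x∈p⇒⁅x⁆⊆p : {x : Fin n} {p : Subset n} → x ∈ p → ⁅ x ⁆ ⊆ p
  x∈p⇒⁅x⁆⊆p {p = p} x∈p y∈⁅x⁆ = subst (_∈ p) (sym (Equivalence.to x∈⁅y⁆⇔x≡y y∈⁅x⁆)) x∈p

  letters-++ : (α β : Word n) → letters (α ++ β) ≡ letters α ∪ letters β
  letters-++ []      β = sym (∪-identityˡ (letters β))
  letters-++ (x ∷ α) β = trans (cong (⁅ x ⁆ ∪_) (letters-++ α β)) (sym (∪-assoc ⁅ x ⁆ (letters α) (letters β)))

  letters-∷ʳ : (α : Word n) (x : Fin n) → letters (α ∷ʳ x) ≡ letters α ∪ ⁅ x ⁆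
  letters-∷ʳ α x = trans (letters-++ α [ x ]) (cong (letters α ∪_) (∪-identityʳ ⁅ x ⁆))

  letters-⊆-++ : (α β : Word n) → letters α ⊆ letters (α ++ β)
  letters-⊆-++ α β = subst (letters α ⊆_) (sym (letters-++ α β)) (p⊆p∪q (letters β))

  ∈⇒∈-letters : {x : Fin n} {α : Word n} → x ∈ₗ α → x ∈ letters α
  ∈⇒∈-letters {α = y ∷ α} (here refl) = p⊆p∪q (letters α) (Equivalence.from x∈⁅y⁆⇔x≡y refl)
  ∈⇒∈-letters {α = y ∷ α} (there x∈α) = q⊆p∪q ⁅ y ⁆ (letters α) (∈⇒∈-letters x∈α)

  elements : Subset n → Word n
  elements p = filter (_∈? p) (allFin n)

  ∈-elements⁺ : {x : Fin n} {p : Subset n} → x ∈ p → x ∈ₗ elements p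
  ∈-elements⁺ {x} {p} x∈p = ∈-filter⁺ (_∈? p) (∈-allFin x) x∈p

  ∈-elements⁻ : {x : Fin n} {p : Subset n} → x ∈ₗ elements p → x ∈ p
  ∈-elements⁻ {p = p} x∈ = proj₂ (∈-filter⁻ (_∈? p) {xs = allFin n} x∈)

module PolymatroidRank {n : ℕ} {ρ : Subset n → ℤ} (P : IsPolymatroid ρ) where
  open IsPolymatroid P

  -- ρ is nonnegative (monotone with ρ ∅ = 0), so we work with its natural-number values.
  r : Subset n → ℕ
  r X = ∣ ρ X ∣

  ρ≡+r : (X : Subset n) → ρ X ≡ + r X
  ρ≡+r X = sym (0≤i⇒+∣i∣≡i (subst (ℤ._≤ ρ X) empty (monotone _ X ⊥⊆)))

  r≡⇔ρ≡ : {X Y : Subset n} → r X ≡ r Y ⇔ ρ X ≡ ρ Y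
  r≡⇔ρ≡ {X} {Y} = mk⇔ (λ eq → trans (ρ≡+r X) (trans (cong +_ eq) (sym (ρ≡+r Y)))) (cong ∣_∣)

  r-mono : {X Y : Subset n} → X ⊆ Y → r X ≤ r Y
  r-mono {X} {Y} X⊆Y = drop‿+≤+ (subst₂ ℤ._≤_ (ρ≡+r X) (ρ≡+r Y) (monotone X Y X⊆Y))

  r-submodular : (X Y : Subset n) → r (X ∪ Y) + r (X ∩ Y) ≤ r X + r Y
  r-submodular X Y = drop‿+≤+ (subst₂ ℤ._≤_ (cong₂ ℤ._+_ (ρ≡+r _) (ρ≡+r _)) (cong₂ ℤ._+_ (ρ≡+r X) (ρ≡+r Y))
                                             (submodular X Y))

  increment-antitone : {X Y Z : Subset n} (d : ℕ) → X ⊆ Y → r (X ∪ Z) ≤ d + r X → r (Y ∪ Z) ≤ d + r Y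
  increment-antitone {X} {Y} {Z} d X⊆Y incr = +-cancelˡ-≤ (r X) _ _ (begin
    r X + r (Y ∪ Z)                    ≡⟨ +-comm (r X) _ ⟩
    r (Y ∪ Z) + r X                    ≤⟨ +-monoˡ-≤ (r X) (r-mono (∪-lub (p⊆p∪q _) (q⊆p∪q Y _ ∘ q⊆p∪q X Z))) ⟩
    r (Y ∪ (X ∪ Z)) + r X              ≤⟨ +-monoʳ-≤ _ (r-mono (λ x∈X → x∈p∩q⁺ (X⊆Y x∈X , p⊆p∪q Z x∈X))) ⟩
    r (Y ∪ (X ∪ Z)) + r (Y ∩ (X ∪ Z))  ≤⟨ r-submodular Y (X ∪ Z) ⟩
    r Y + r (X ∪ Z)                    ≤⟨ +-monoʳ-≤ (r Y) incr ⟩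
    r Y + (d + r X)                    ≡⟨ swap (r Y) d (r X) ⟩
    r X + (d + r Y)                    ∎)
    where
    open ≤-Reasoning
    swap : ∀ a d b → a + (d + b) ≡ b + (d + a)
    swap = solve-∀

  -- The span σ_ρ; testing ≤ instead of = is equivalent since r is monotone.
  σ : Subset n → Subset n
  σ X = tabulate (λ y → does (r (X ∪ ⁅ y ⁆) ≤? r X))

  ∈σ⁻ : {X : Subset n} {y : Fin n} → y ∈ σ X → r (X ∪ ⁅ y ⁆) ≤ r X
  ∈σ⁻ {X} {y} y∈σX = does-true⇒ (_ ≤? _) (trans (sym (lookup∘tabulate _ y)) ([]=⇒lookup y∈σX))

  ∈σ⁺ : {X : Subset n} {y : Fin n} → r (X ∪ ⁅ y ⁆) ≤ r X → y ∈ σ X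
  ∈σ⁺ {X} {y} incr = lookup⇒[]= y (σ X) (trans (lookup∘tabulate _ y) (dec-true (_ ≤? _) incr))

  ⊆σ : {X : Subset n} → X ⊆ σ X
  ⊆σ y∈X = ∈σ⁺ (r-mono (∪-lub id (x∈p⇒⁅x⁆⊆p y∈X)))

  σ-mono : {X Y : Subset n} → X ⊆ Y → σ X ⊆ σ Y
  σ-mono X⊆Y y∈σX = ∈σ⁺ (increment-antitone 0 X⊆Y (∈σ⁻ y∈σX))

  r-∪-σ-letters : {X : Subset n} (ys : Word n) → (∀ {y} → y ∈ₗ ys → y ∈ σ X) → r (X ∪ letters ys) ≤ r X
  r-∪-σ-letters {X} []       _      = ≤-reflexive (cong r (∪-identityʳ X))
  r-∪-σ-letters {X} (y ∷ ys) ys⊆σX = begin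
    r (X ∪ (⁅ y ⁆ ∪ letters ys))  ≤⟨ r-mono (∪-lub (p⊆p∪q _ ∘ p⊆p∪q _)
                                                  (∪-lub (q⊆p∪q _ _) (p⊆p∪q _ ∘ q⊆p∪q X _))) ⟩
    r ((X ∪ letters ys) ∪ ⁅ y ⁆)  ≤⟨ ∈σ⁻ (σ-mono (p⊆p∪q (letters ys)) (ys⊆σX (here refl))) ⟩
    r (X ∪ letters ys)            ≤⟨ r-∪-σ-letters ys (ys⊆σX ∘ there) ⟩
    r X                           ∎
    where open ≤-Reasoning

  r-σ : (X : Subset n) → r (σ X) ≡ r X
  r-σ X = ≤-antisym (begin
    r (σ X)                            ≤⟨ r-mono (q⊆p∪q X _ ∘ ∈⇒∈-letters ∘ ∈-elements⁺) ⟩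
    r (X ∪ letters (elements (σ X)))   ≤⟨ r-∪-σ-letters _ ∈-elements⁻ ⟩
    r X                                ∎) (r-mono ⊆σ)
    where open ≤-Reasoning

  σ-idem : {X : Subset n} → σ (σ X) ⊆ σ X
  σ-idem {X} {y} y∈σσX = ∈σ⁺ (begin
    r (X ∪ ⁅ y ⁆)    ≤⟨ r-mono (∪-lub (p⊆p∪q _ ∘ ⊆σ) (q⊆p∪q _ _)) ⟩
    r (σ X ∪ ⁅ y ⁆)  ≤⟨ ∈σ⁻ y∈σσX ⟩
    r (σ X)          ≡⟨ r-σ X ⟩
    r X              ∎)
    where open ≤-Reasoning

  ⊆σ⇒σ⊆σ : {X Y : Subset n} → X ⊆ σ Y → σ X ⊆ σ Y
  ⊆σ⇒σ⊆σ X⊆σY = σ-idem ∘ σ-mono X⊆σY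

  σ-closed : (X : Subset n) → Closed ρ (σ X)
  σ-closed X y = mk⇔
    (λ y∈σX → Equivalence.to r≡⇔ρ≡ (≤-antisym (r-mono (∪-lub id (x∈p⇒⁅x⁆⊆p y∈σX))) (r-mono (p⊆p∪q _))))
    (λ eq → σ-idem (∈σ⁺ (≤-reflexive (Equivalence.from r≡⇔ρ≡ eq))))

  closed-⊂⇒r< : {X Y : Subset n} → Closed ρ X → X ⊂ Y → r X < r Y
  closed-⊂⇒r< {X} {Y} X-closed (X⊆Y , z , z∈Y , z∉X) = begin-strict
    r X            <⟨ ≤∧≢⇒< (r-mono (p⊆p∪q _)) z-raises-rank ⟩
    r (X ∪ ⁅ z ⁆)  ≤⟨ r-mono (∪-lub X⊆Y (x∈p⇒⁅x⁆⊆p z∈Y)) ⟩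
    r Y            ∎
    where
    open ≤-Reasoning
    z-raises-rank : r X ≢ r (X ∪ ⁅ z ⁆)
    z-raises-rank eq = z∉X (Equivalence.from (X-closed z) (Equivalence.to r≡⇔ρ≡ (sym eq)))

module Representation {n : ℕ} {Λ : Language n} {ρ : Subset n → ℤ}
                      (P : IsPolymatroid ρ) (R : Represents ρ Λ) where
  open PolymatroidRank P

  r-letters : {α : Word n} → Λ α → r (letters α) ≡ length α
  r-letters {α} Λα = cong ∣_∣ (subst (λ w → ρ (letters w) ≡ + length α) (take-all (length α) α ≤-refl)
                                     (Equivalence.to (R α) Λα (length α) ≤-refl))

  prefix-closed : (α : Word n) {β : Word n} → Λ (α ++ β) → Λ α
  prefix-closed α {β} Λαβ = Equivalence.from (R α) λ i i≤α →
    subst (λ w → ρ (letters w) ≡ + i) (take-++ˡ α β i≤α)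
          (Equivalence.to (R (α ++ β)) Λαβ i (≤-trans i≤α (length-++-≤ˡ α)))

  r-∷ʳ : {α : Word n} {x : Fin n} → Λ (α ∷ʳ x) → r (letters α ∪ ⁅ x ⁆) ≡ suc (length α)
  r-∷ʳ {α} {x} Λαx = subst₂ (λ X k → r X ≡ k) (letters-∷ʳ α x) (length-∷ʳ α x) (r-letters Λαx)

  ∷ʳ-feasible : {α : Word n} {x : Fin n} → Λ α → r (letters α ∪ ⁅ x ⁆) ≡ suc (length α) → Λ (α ∷ʳ x)
  ∷ʳ-feasible {α} {x} Λα r≡ = Equivalence.from (R (α ∷ʳ x)) prefix-ranks
    where
    prefix-ranks : ∀ i → i ≤ length (α ∷ʳ x) → ρ (letters (take i (α ∷ʳ x))) ≡ + i
    prefix-ranks i i≤ with m≤n⇒m<n∨m≡n (subst (i ≤_) (length-∷ʳ α x) i≤)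
    ... | inj₁ i<suc = subst (λ w → ρ (letters w) ≡ + i) (sym (take-++ˡ α [ x ] (m<1+n⇒m≤n i<suc)))
                             (Equivalence.to (R α) Λα i (m<1+n⇒m≤n i<suc))
    ... | inj₂ refl  = begin
      ρ (letters (take i (α ∷ʳ x)))  ≡⟨ cong (ρ ∘ letters) (take-all i (α ∷ʳ x) (≤-reflexive (length-∷ʳ α x))) ⟩
      ρ (letters (α ∷ʳ x))           ≡⟨ cong ρ (letters-∷ʳ α x) ⟩
      ρ (letters α ∪ ⁅ x ⁆)          ≡⟨ ρ≡+r _ ⟩
      + r (letters α ∪ ⁅ x ⁆)        ≡⟨ cong +_ r≡ ⟩
      + suc (length α)               ∎
      where open ≡-Reasoning

  ∷ʳ-feasible⇒∉σ : {α : Word n} {x : Fin n} → Λ (α ∷ʳ x) → x ∉ σ (letters α)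
  ∷ʳ-feasible⇒∉σ {α} {x} Λαx x∈σα = 1+n≰n (begin
    suc (length α)         ≡⟨ sym (r-∷ʳ Λαx) ⟩
    r (letters α ∪ ⁅ x ⁆)  ≤⟨ ∈σ⁻ x∈σα ⟩
    r (letters α)          ≡⟨ r-letters (prefix-closed α Λαx) ⟩
    length α               ∎)
    where open ≤-Reasoning

  ∈⇒¬∷ʳ-feasible : {α : Word n} {x : Fin n} → x ∈ₗ α → ¬ Λ (α ∷ʳ x)
  ∈⇒¬∷ʳ-feasible x∈α Λαx = ∷ʳ-feasible⇒∉σ Λαx (⊆σ (∈⇒∈-letters x∈α))

  r-increment≤1 : {γ : Word n} {x : Fin n} {Y : Subset n} →
                  Λ (γ ∷ʳ x) → letters γ ⊆ Y → r (Y ∪ ⁅ x ⁆) ≤ suc (r Y)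
  r-increment≤1 {γ} Λγx γ⊆Y = increment-antitone 1 γ⊆Y
    (≤-reflexive (trans (r-∷ʳ Λγx) (cong suc (sym (r-letters (prefix-closed γ Λγx))))))

  -- Integrality: an increment that is at most one but not one is zero.
  ¬∷ʳ-feasible⇒∈σ : {β γ : Word n} {x : Fin n} → Λ β → Λ (γ ∷ʳ x) →
                    letters γ ⊆ σ (letters β) → ¬ Λ (β ∷ʳ x) → x ∈ σ (letters β)
  ¬∷ʳ-feasible⇒∈σ {β} {γ} {x} Λβ Λγx γ⊆σβ ¬Λβx = ∈σ⁺ (m<1+n⇒m≤n (≤∧≢⇒< increment≤1 increment≢1))
    where
    open ≤-Reasoning
    increment≤1 : r (letters β ∪ ⁅ x ⁆) ≤ suc (r (letters β))
    increment≤1 = begin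
      r (letters β ∪ ⁅ x ⁆)      ≤⟨ r-mono (∪-lub (p⊆p∪q _ ∘ ⊆σ) (q⊆p∪q _ _)) ⟩
      r (σ (letters β) ∪ ⁅ x ⁆)  ≤⟨ r-increment≤1 Λγx γ⊆σβ ⟩
      suc (r (σ (letters β)))    ≡⟨ cong suc (r-σ (letters β)) ⟩
      suc (r (letters β))        ∎
    increment≢1 : r (letters β ∪ ⁅ x ⁆) ≢ suc (r (letters β))
    increment≢1 eq = ¬Λβx (∷ʳ-feasible Λβ (trans eq (cong suc (r-letters Λβ))))

  letters⊆σ : {α β : Word n} → Λ α → Λ β → (∀ {x} → x ∈ₗ α → ¬ Λ (β ∷ʳ x)) →
              letters α ⊆ σ (letters β)
  letters⊆σ {α} {β} Λα Λβ α-blocked = go [] α ⊥⊆ Λα α-blocked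
    where
    go : ∀ γ δ → letters γ ⊆ σ (letters β) → Λ (γ ++ δ) → (∀ {x} → x ∈ₗ δ → ¬ Λ (β ∷ʳ x)) →
         letters δ ⊆ σ (letters β)
    go γ []      _    _    _         = ⊥⊆
    go γ (x ∷ δ) γ⊆σβ Λγxδ xδ-blocked =
      ∪-lub (x∈p⇒⁅x⁆⊆p x∈σβ) (go (γ ∷ʳ x) δ γx⊆σβ Λγx++δ (xδ-blocked ∘ there))
      where
      Λγx++δ : Λ ((γ ∷ʳ x) ++ δ)
      Λγx++δ = subst Λ (sym (∷ʳ-++ γ x δ)) Λγxδ
      x∈σβ : x ∈ σ (letters β)
      x∈σβ = ¬∷ʳ-feasible⇒∈σ Λβ (prefix-closed (γ ∷ʳ x) Λγx++δ) γ⊆σβ (xδ-blocked (here refl))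
      γx⊆σβ : letters (γ ∷ʳ x) ⊆ σ (letters β)
      γx⊆σβ = subst (_⊆ σ (letters β)) (sym (letters-∷ʳ γ x)) (∪-lub γ⊆σβ (x∈p⇒⁅x⁆⊆p x∈σβ))

  φ : Word n → Subset n
  φ α = σ (letters α)

  r-φ : {α : Word n} → Λ α → r (φ α) ≡ length α
  r-φ {α} Λα = trans (r-σ (letters α)) (r-letters Λα)

  ∼⇒φ⊆ : {α β : Word n} → Λ α → Λ β → _∼_ Λ α β → φ α ⊆ φ β
  ∼⇒φ⊆ Λα Λβ α∼β = ⊆σ⇒σ⊆σ (letters⊆σ Λα Λβ λ {x} x∈α Λβx →
    ∈⇒¬∷ʳ-feasible x∈α (Equivalence.from (α∼β x) Λβx))

  ∼⇒φ≡ : {α β : Word n} → Λ α → Λ β → _∼_ Λ α β → φ α ≡ φ β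
  ∼⇒φ≡ Λα Λβ α∼β = ⊆-antisym (∼⇒φ⊆ Λα Λβ α∼β) (∼⇒φ⊆ Λβ Λα (⇔.sym ∘ α∼β))

  ∼⇒length≡ : {α β : Word n} → Λ α → Λ β → _∼_ Λ α β → length α ≡ length β
  ∼⇒length≡ {α} {β} Λα Λβ α∼β = begin
    length α  ≡⟨ sym (r-φ Λα) ⟩
    r (φ α)   ≡⟨ cong r (∼⇒φ≡ Λα Λβ α∼β) ⟩
    r (φ β)   ≡⟨ r-φ Λβ ⟩
    length β  ∎
    where open ≡-Reasoning

  ⊏⇒φ⊂ : {α β : Word n} → Λ β → _⊏_ Λ α β → φ α ⊂ φ β
  ⊏⇒φ⊂ Λβ ([] , []≢[] , _) = ⊥-elim ([]≢[] refl)
  ⊏⇒φ⊂ {α} Λβ (z ∷ δ , _ , Λαzδ , αzδ∼β) = subst (φ α ⊂_) (∼⇒φ≡ Λαzδ Λβ αzδ∼β)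
    ( σ-mono (letters-⊆-++ α (z ∷ δ))
    , z
    , ⊆σ (∈⇒∈-letters (∈-++⁺ʳ α (here refl)))
    , ∷ʳ-feasible⇒∉σ (prefix-closed (α ∷ʳ z) (subst Λ (sym (∷ʳ-++ α z δ)) Λαzδ)))

  ⊏-intermediate : {α β : Word n} → Λ β → _⊏_ Λ α β → 2 + length α ≤ length β →
                   ∃ λ γ → Λ γ × _⊏_ Λ α γ × _⊏_ Λ γ β
  ⊏-intermediate Λβ ([] , []≢[] , _) _ = ⊥-elim ([]≢[] refl)
  ⊏-intermediate {α} Λβ (z ∷ [] , _ , Λαz , αz∼β) 2+α≤β =
    ⊥-elim (1+n≰n (subst (2 + length α ≤_) (trans (sym (∼⇒length≡ Λαz Λβ αz∼β)) (length-∷ʳ α z)) 2+α≤β))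
  ⊏-intermediate {α} {β} Λβ (z ∷ y ∷ δ , _ , Λαzyδ , αzyδ∼β) _ =
    α ∷ʳ z , Λαz , ([ z ] , (λ ()) , Λαz , λ _ → ⇔.refl) , (y ∷ δ , (λ ()) , Λαz++yδ , αz++yδ∼β)
    where
    Λαz++yδ : Λ ((α ∷ʳ z) ++ y ∷ δ)
    Λαz++yδ = subst Λ (sym (∷ʳ-++ α z (y ∷ δ))) Λαzyδ
    αz++yδ∼β : _∼_ Λ ((α ∷ʳ z) ++ y ∷ δ) β
    αz++yδ∼β = subst (λ w → _∼_ Λ w β) (sym (∷ʳ-++ α z (y ∷ δ))) αzyδ∼β
    Λαz : Λ (α ∷ʳ z)
    Λαz = prefix-closed (α ∷ʳ z) Λαz++yδ

  ≺⇒φ≺ρ : {α β : Word n} → Λ α → Λ β → _≺_ Λ α β → _≺ρ_ ρ (φ α) (φ β)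
  ≺⇒φ≺ρ {α} {β} Λα Λβ (α⊏β , no-intermediate) = ⊏⇒φ⊂ Λβ α⊏β , λ (Z , Z-closed , φα⊂Z , Z⊂φβ) →
    no-intermediate (⊏-intermediate Λβ α⊏β (begin
      2 + length α  ≡⟨ cong (suc ∘ suc) (sym (r-φ Λα)) ⟩
      2 + r (φ α)   ≤⟨ s≤s (closed-⊂⇒r< (σ-closed (letters α)) φα⊂Z) ⟩
      suc (r Z)     ≤⟨ closed-⊂⇒r< Z-closed Z⊂φβ ⟩
      r (φ β)       ≡⟨ r-φ Λβ ⟩
      length β      ∎))
    where open ≤-Reasoning

mainTheorem3 : (n : ℕ) (Λ : Language n) → IsGreedoid Λ → Normal Λ →
               (ρ : Subset n → ℤ) → IsPolymatroid ρ → Represents ρ Λ →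
               Aligned Λ ρ
mainTheorem3 n Λ _ _ ρ P R = R , φ , record
  { wellDefined = λ _ _ → ∼⇒φ≡
  ; closed      = λ α _ → σ-closed (letters α)
  ; monotone    = λ _ _ _ → ⊏⇒φ⊂
  ; sameRank    = λ α _ → Equivalence.to r≡⇔ρ≡ (sym (r-σ (letters α)))
  ; contains    = λ _ _ → ⊆σ
  ; covers      = λ _ _ → ≺⇒φ≺ρ
  }
  where
  open PolymatroidRank P
  open Representation P R
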